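{- Let $T$ be a tree of order $n\geq 4$ that has a quasi-star vertex $y$. Then $$w_2(T)=w_2(T_y^{ -1})+w_2(T_y^{ -2}).$$ Moreover, $w_2(K_{1,r})=1$ for every $r\geq 1$.
   Context: For a graph $G$, $w_2(G)$ denotes the number of unordered partitions of $V(G)$ into two nonempty dominating sets (a dominating set $S$ being one such that every vertex outside $S$ has a neighbor in $S$); equivalently, the number of weak 2-colorings of $G$ (assignments of one of two colors to each vertex so that every non-isolated vertex has a neighbor of a different color) counted up to interchanging the two colors. In a tree $T$, a leaf is a vertex of degree 1 and a support vertex is a vertex adjacent to a leaf. For a support vertex $u$, $ones(u)$ is the set of leaves adjacent to $u$; $T_u^{ -1}$ is the tree obtained from $T$ by deleting the vertices of $ones(u)$, and $T_u^{ -2}$ is the tree obtained from $T$ by deleting the vertices of $ones(u)\cup\{u\}$. A vertex $v$ of a tree is a quasi-star vertex if $v$ is adjacent to exactly one non-leaf vertex and to at least one leaf. -}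

module Defs where

open import Data.Nat using (ℕ; zero; suc; _+_; _/_; _≡ᵇ_; _≤_)
open import Data.Bool using (Bool; true; false; _∧_; _∨_; not)
open import Data.Fin using (Fin; zero; suc)
open import Data.List using (List; []; _∷_; length; concatMap; allFin; _∷ʳ_)
open import Data.Bool.ListAction using (all; any)
open import Data.List.Relation.Unary.Unique.Propositional using (Unique)
open import Data.List.Relation.Unary.Linked using (Linked)
open import Data.Product using (Σ; _×_)
open import Relation.Binary.PropositionalEquality using (_≡_)
open import Relation.Nullary using (¬_)

record Graph (n : ℕ) : Set where
  field
    adj    : Fin n → Fin n → Bool
    sym    : ∀ u v → adj u v ≡ adj v u
    irrefl : ∀ v → adj v v ≡ false
open Graph public

countB : ∀ {A : Set} → (A → Bool) → List A → ℕ
countB p []       = 0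
countB p (x ∷ xs) with p x
... | true  = suc (countB p xs)
... | false = countB p xs

data Walk {n : ℕ} (G : Graph n) : Fin n → Fin n → Set where
  here : ∀ {v} → Walk G v v
  step : ∀ {u w v} → adj G u w ≡ true → Walk G w v → Walk G u v

Connected : ∀ {n} → Graph n → Set
Connected {n} G = (u v : Fin n) → Walk G u v

IsCycle : ∀ {n} → Graph n → Fin n → List (Fin n) → Set
IsCycle G v ys =
  2 ≤ length ys × Unique (v ∷ ys) × Linked (λ a b → adj G a b ≡ true) ((v ∷ ys) ∷ʳ v)

Acyclic : ∀ {n} → Graph n → Set
Acyclic {n} G = (v : Fin n) (ys : List (Fin n)) → ¬ IsCycle G v ys

IsTree : ∀ {n} → Graph n → Set
IsTree G = Connected G × Acyclic G

degree : ∀ {n} → Graph n → Fin n → ℕ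
degree {n} G v = countB (adj G v) (allFin n)

isLeaf : ∀ {n} → Graph n → Fin n → Bool
isLeaf G v = degree G v ≡ᵇ 1

IsQuasiStar : ∀ {n} → Graph n → Fin n → Set
IsQuasiStar {n} G y =
  countB (λ u → adj G y u ∧ not (isLeaf G u)) (allFin n) ≡ 1
  × Σ (Fin n) (λ u → adj G y u ≡ true × isLeaf G u ≡ true)

inOnes : ∀ {n} → Graph n → Fin n → Fin n → Bool
inOnes G y u = adj G y u ∧ isLeaf G u

-- vertex sets (as characteristic functions) of T_y^{-1} and T_y^{-2}
-- (these are induced subgraphs of T)
minus1 : ∀ {n} → Graph n → Fin n → (Fin n → Bool)
minus1 G y u = not (inOnes G y u)

eqFin : ∀ {n} → Fin n → Fin n → Bool
eqFin zero    zero    = true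
eqFin zero    (suc _) = false
eqFin (suc _) zero    = false
eqFin (suc a) (suc b) = eqFin a b

minus2 : ∀ {n} → Graph n → Fin n → (Fin n → Bool)
minus2 G y u = not (inOnes G y u) ∧ not (eqFin u y)

consB : ∀ {n} → Bool → (Fin n → Bool) → (Fin (suc n) → Bool)
consB b f zero    = b
consB b f (suc i) = f i

allSubsets : (n : ℕ) → List (Fin n → Bool)
allSubsets zero    = (λ ()) ∷ []
allSubsets (suc n) = concatMap (λ f → consB false f ∷ consB true f ∷ []) (allSubsets n)

dominatingIn : ∀ {n} → Graph n → (Fin n → Bool) → (Fin n → Bool) → Bool
dominatingIn {n} G U S =
  all (λ v → not (U v) ∨ S v ∨ any (λ u → S u ∧ adj G v u) (allFin n)) (allFin n)

goodPart : ∀ {n} → Graph n → (Fin n → Bool) → (Fin n → Bool) → Bool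
goodPart {n} G U S =
  all (λ v → not (S v) ∨ U v) (allFin n)
  ∧ any S (allFin n)
  ∧ any (λ v → U v ∧ not (S v)) (allFin n)
  ∧ dominatingIn G U S
  ∧ dominatingIn G U (λ v → U v ∧ not (S v))

-- unordered partitions: each ordered pair (S, U∖S) counted twice, hence / 2
w₂On : ∀ {n} → Graph n → (Fin n → Bool) → ℕ
w₂On {n} G U = countB (goodPart G U) (allSubsets n) / 2

w₂ : ∀ {n} → Graph n → ℕ
w₂ G = w₂On G (λ _ → true)

-- the star K_{1,r} on Fin (suc r), centre zero
starAdj : ∀ {r} → Fin (suc r) → Fin (suc r) → Bool
starAdj zero    zero    = false
starAdj zero    (suc _) = true
starAdj (suc _) zero    = true
starAdj (suc _) (suc _) = false

starSym : ∀ {r} (u v : Fin (suc r)) → starAdj u v ≡ starAdj v u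
starSym zero    zero    = Relation.Binary.PropositionalEquality.refl
starSym zero    (suc _) = Relation.Binary.PropositionalEquality.refl
starSym (suc _) zero    = Relation.Binary.PropositionalEquality.refl
starSym (suc _) (suc _) = Relation.Binary.PropositionalEquality.refl

starIrr : ∀ {r} (v : Fin (suc r)) → starAdj v v ≡ false
starIrr zero    = Relation.Binary.PropositionalEquality.refl
starIrr (suc _) = Relation.Binary.PropositionalEquality.refl

K1 : (r : ℕ) → Graph (suc r)
K1 r = record { adj = starAdj ; sym = starSym ; irrefl = starIrr }

{-# OPTIONS --safe #-}
module Submission where

-- Let x be the unique non-leaf neighbour of the quasi-star vertex y and L = ones(y). In a
-- partition of V(G) into two dominating sets every vertex of L lies opposite y. If x lies
-- opposite y, deleting L leaves such a partition of T_y^{-1}; if x lies with y, then y is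
-- dominated only by its leaves, and deleting L ∪ {y} leaves such a partition of T_y^{-2}.
-- Both steps are undone by putting L opposite y and y with x. On characteristic functions
-- these bijections are masked flips S ↦ S xor (M ∧ h S), where h reads S only outside M;
-- such a map is an involution, so it preserves the number of subsets with any property.
-- Counting ordered partitions (twice w₂, by complementation) gives the recurrence. In a star the colour of the centre determines the partition.

open import Defs hiding (sym)
open import Data.Bool using (Bool; true; false; _∧_; _∨_; not; _xor_; T)
open import Data.Bool.ListAction using (all; any)
open import Data.Bool.Properties
  using (xor-identityʳ; xor-comm; xor-assoc; xor-same; not-involutive; not-injective; ¬-not; not-¬;
         ∧-zeroʳ; T-≡; T-not-≡; T-∧; ⇔→≡)
  renaming (_≟_ to _≟ᵇ_)
open import Data.Fin using (Fin; zero; suc)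
open import Data.Fin.Properties using (_≟_)
open import Data.List using (List; []; _∷_; concatMap; allFin; tabulate)
import Data.List.Relation.Unary.All.Properties as All
import Data.List.Relation.Unary.Any.Properties as Any
open import Data.Nat using (ℕ; zero; suc; _+_; _*_; _/_; _≤_)
open import Data.Nat.DivMod using (m*n/n≡m)
open import Data.Nat.Properties
  using (+-comm; +-assoc; +-identityʳ; *-comm; *-distribˡ-+; *-cancelˡ-≡; suc-injective; ≡ᵇ⇒≡;
         +-commutativeSemigroup)
open import Algebra.Properties.CommutativeSemigroup +-commutativeSemigroup
  using () renaming (interchange to +-interchange)
open import Data.Product using (∃; ∃!; _×_; _,_; proj₁; proj₂)
open import Data.Sum using (_⊎_; inj₁; inj₂; [_,_])
open import Data.Unit using (tt)
open import Function using (_∘_; _⇔_; mk⇔; Equivalence)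
open import Relation.Binary.PropositionalEquality hiding ([_])
open import Relation.Nullary using (¬_; contradiction; yes; no)

open Equivalence using (to; from)

true≢false : true ≢ false
true≢false ()

∧≡true⇒ˡ : ∀ {a b} → a ∧ b ≡ true → a ≡ true
∧≡true⇒ˡ {true} _ = refl

∧≡true⇒ʳ : ∀ {a b} → a ∧ b ≡ true → b ≡ true
∧≡true⇒ʳ {true} b≡true = b≡true

xor≡false⇒≡ : ∀ {a b} → a xor b ≡ false → a ≡ b
xor≡false⇒≡ {true}  {true}  _ = refl
xor≡false⇒≡ {false} {false} _ = refl

≡⇒xor≡false : ∀ {a b} → a ≡ b → a xor b ≡ false
≡⇒xor≡false {a} refl = xor-same a

≡not-sym : ∀ {a b} → a ≡ not b → b ≡ not a
≡not-sym {b = b} a≡¬b = trans (sym (not-involutive b)) (cong not (sym a≡¬b))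

≡not-resp : ∀ {a a′ b b′} → a′ ≡ a → b′ ≡ b → a ≡ not b → a′ ≡ not b′
≡not-resp a′≡a b′≡b a≡¬b = trans a′≡a (trans a≡¬b (cong not (sym b′≡b)))

T-⇒⁻ : ∀ {a b} → T (not a ∨ b) → T a → T b
T-⇒⁻ {true} h _ = h

T-⇒⁺ : ∀ {a b} → (T a → T b) → T (not a ∨ b)
T-⇒⁺ {true}  f = f tt
T-⇒⁺ {false} f = tt

T-∨-resolve : ∀ {a b} → a ≡ false → T (a ∨ b) → T b
T-∨-resolve refl h = h

module _ {n : ℕ} (p : Fin n → Bool) where

  all-allFin⁻ : T (all p (allFin n)) → ∀ i → T (p i)
  all-allFin⁻ h = All.tabulate⁻ (All.all⁺ p (allFin n) h)

  all-allFin⁺ : (∀ i → T (p i)) → T (all p (allFin n))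
  all-allFin⁺ h = All.all⁻ p (All.tabulate⁺ h)

  any-allFin⁻ : T (any p (allFin n)) → ∃ λ i → T (p i)
  any-allFin⁻ h = Any.tabulate⁻ (Any.any⁻ p (allFin n) h)

  any-allFin⁺ : ∀ i → T (p i) → T (any p (allFin n))
  any-allFin⁺ i h = Any.any⁺ p (Any.tabulate⁺ i h)

toℕ : Bool → ℕ
toℕ true  = 1
toℕ false = 0

toℕ-∧-split : (a b : Bool) → toℕ a ≡ toℕ (a ∧ b) + toℕ (a ∧ not b)
toℕ-∧-split true  true  = refl
toℕ-∧-split true  false = refl
toℕ-∧-split false _     = refl

toℕ-sum-xor : (f : Bool → Bool) (c : Bool) →
              toℕ (f false) + toℕ (f true) ≡ toℕ (f (false xor c)) + toℕ (f (true xor c))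
toℕ-sum-xor f false = refl
toℕ-sum-xor f true  = +-comm (toℕ (f false)) (toℕ (f true))

toℕ-exclusive-or : ∀ {a b c} → (a ≡ true ⇔ (b ≡ true ⊎ c ≡ true)) → ¬ (b ≡ true × c ≡ true) →
                   toℕ a ≡ toℕ b + toℕ c
toℕ-exclusive-or {true}  {true}  {true}  _  exclusive = contradiction (refl , refl) exclusive
toℕ-exclusive-or {true}  {true}  {false} _  _ = refl
toℕ-exclusive-or {true}  {false} {true}  _  _ = refl
toℕ-exclusive-or {true}  {false} {false} a⇔ _ with to a⇔ refl
... | inj₁ ()
... | inj₂ ()
toℕ-exclusive-or {false} {true}  {_}     a⇔ _ = contradiction (from a⇔ (inj₁ refl)) (true≢false ∘ sym)
toℕ-exclusive-or {false} {false} {true}  a⇔ _ = contradiction (from a⇔ (inj₂ refl)) (true≢false ∘ sym)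
toℕ-exclusive-or {false} {false} {false} _  _ = refl

module _ {A : Set} where

  countB-∷ : (p : A → Bool) (x : A) (xs : List A) → countB p (x ∷ xs) ≡ toℕ (p x) + countB p xs
  countB-∷ p x xs with p x
  ... | true  = refl
  ... | false = refl

  countB-cong : {p q : A → Bool} → (∀ a → p a ≡ q a) → (xs : List A) → countB p xs ≡ countB q xs
  countB-cong p≗q []       = refl
  countB-cong {p} {q} p≗q (x ∷ xs) = begin
    countB p (x ∷ xs)          ≡⟨ countB-∷ p x xs ⟩
    toℕ (p x) + countB p xs    ≡⟨ cong₂ _+_ (cong toℕ (p≗q x)) (countB-cong p≗q xs) ⟩
    toℕ (q x) + countB q xs    ≡⟨ countB-∷ q x xs ⟨
    countB q (x ∷ xs)          ∎
    where open ≡-Reasoning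

  countB-+ : {p q r s : A → Bool} → (∀ a → toℕ (p a) + toℕ (q a) ≡ toℕ (r a) + toℕ (s a)) →
             (xs : List A) → countB p xs + countB q xs ≡ countB r xs + countB s xs
  countB-+ pq≗rs [] = refl
  countB-+ {p} {q} {r} {s} pq≗rs (x ∷ xs) = begin
    countB p (x ∷ xs) + countB q (x ∷ xs)
      ≡⟨ cong₂ _+_ (countB-∷ p x xs) (countB-∷ q x xs) ⟩
    (toℕ (p x) + countB p xs) + (toℕ (q x) + countB q xs)
      ≡⟨ +-interchange (toℕ (p x)) (countB p xs) (toℕ (q x)) (countB q xs) ⟩
    (toℕ (p x) + toℕ (q x)) + (countB p xs + countB q xs)
      ≡⟨ cong₂ _+_ (pq≗rs x) (countB-+ pq≗rs xs) ⟩
    (toℕ (r x) + toℕ (s x)) + (countB r xs + countB s xs)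
      ≡⟨ +-interchange (toℕ (r x)) (toℕ (s x)) (countB r xs) (countB s xs) ⟩
    (toℕ (r x) + countB r xs) + (toℕ (s x) + countB s xs)
      ≡⟨ cong₂ _+_ (countB-∷ r x xs) (countB-∷ s x xs) ⟨
    countB r (x ∷ xs) + countB s (x ∷ xs) ∎
    where open ≡-Reasoning

  countB-split : {p q r : A → Bool} → (∀ a → toℕ (p a) ≡ toℕ (q a) + toℕ (r a)) →
                 (xs : List A) → countB p xs ≡ countB q xs + countB r xs
  countB-split p≗q+r [] = refl
  countB-split {p} {q} {r} p≗q+r (x ∷ xs) = begin
    countB p (x ∷ xs)
      ≡⟨ countB-∷ p x xs ⟩
    toℕ (p x) + countB p xs
      ≡⟨ cong₂ _+_ (p≗q+r x) (countB-split p≗q+r xs) ⟩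
    (toℕ (q x) + toℕ (r x)) + (countB q xs + countB r xs)
      ≡⟨ +-interchange (toℕ (q x)) (toℕ (r x)) (countB q xs) (countB r xs) ⟩
    (toℕ (q x) + countB q xs) + (toℕ (r x) + countB r xs)
      ≡⟨ cong₂ _+_ (countB-∷ q x xs) (countB-∷ r x xs) ⟨
    countB q (x ∷ xs) + countB r (x ∷ xs) ∎
    where open ≡-Reasoning

  countB-none : (p : A → Bool) → (∀ a → p a ≡ false) → (xs : List A) → countB p xs ≡ 0
  countB-none p p≡false [] = refl
  countB-none p p≡false (x ∷ xs) rewrite p≡false x = countB-none p p≡false xs

  countB-tabulate≡0 : (p : A → Bool) {n : ℕ} (f : Fin n → A) → countB p (tabulate f) ≡ 0 →
                      ∀ i → p (f i) ≡ false
  countB-tabulate≡0 p {suc n} f count≡0 i with p (f zero) in p₀ | count≡0 | i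
  ... | false | _      | zero  = p₀
  ... | false | rest≡0 | suc j = countB-tabulate≡0 p (f ∘ suc) rest≡0 j

  countB-tabulate≡1 : (p : A → Bool) {n : ℕ} (f : Fin n → A) → countB p (tabulate f) ≡ 1 →
                      ∃! _≡_ (λ i → p (f i) ≡ true)
  countB-tabulate≡1 p {suc n} f count≡1 with p (f zero) in p₀ | count≡1
  ... | true  | rest≡1 = zero , p₀ , λ
          { {zero}  _   → refl
          ; {suc j} pfj → contradiction (trans (sym pfj) (countB-tabulate≡0 p (f ∘ suc) (suc-injective rest≡1) j))
                                        true≢false
          }
  ... | false | rest≡1 with countB-tabulate≡1 p (f ∘ suc) rest≡1
  ...   | i , pfi , unique = suc i , pfi , λ
          { {zero}  pf₀ → contradiction (trans (sym pf₀) p₀) true≢false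
          ; {suc j} pfj → cong suc (unique pfj)
          }

countB-pairs : {A B : Set} (q : B → Bool) (a b : A → B) (xs : List A) →
               countB q (concatMap (λ x → a x ∷ b x ∷ []) xs) ≡ countB (q ∘ a) xs + countB (q ∘ b) xs
countB-pairs q a b [] = refl
countB-pairs q a b (x ∷ xs) = begin
  countB q (a x ∷ b x ∷ concatMap (λ x → a x ∷ b x ∷ []) xs)
    ≡⟨ countB-∷ q (a x) _ ⟩
  toℕ (q (a x)) + countB q (b x ∷ concatMap (λ x → a x ∷ b x ∷ []) xs)
    ≡⟨ cong (toℕ (q (a x)) +_) (trans (countB-∷ q (b x) _) (cong (toℕ (q (b x)) +_) (countB-pairs q a b xs))) ⟩
  toℕ (q (a x)) + (toℕ (q (b x)) + (countB (q ∘ a) xs + countB (q ∘ b) xs))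
    ≡⟨ +-assoc (toℕ (q (a x))) _ _ ⟨
  (toℕ (q (a x)) + toℕ (q (b x))) + (countB (q ∘ a) xs + countB (q ∘ b) xs)
    ≡⟨ +-interchange (toℕ (q (a x))) _ _ _ ⟩
  (toℕ (q (a x)) + countB (q ∘ a) xs) + (toℕ (q (b x)) + countB (q ∘ b) xs)
    ≡⟨ cong₂ _+_ (countB-∷ (q ∘ a) x xs) (countB-∷ (q ∘ b) x xs) ⟨
  countB (q ∘ a) (x ∷ xs) + countB (q ∘ b) (x ∷ xs) ∎
  where open ≡-Reasoning
-- Subsets of Fin n and masked flips

Subset : ℕ → Set
Subset n = Fin n → Bool

countSubsets : (n : ℕ) → (Subset n → Bool) → ℕ
countSubsets n q = countB q (allSubsets n)

countSubsets-suc : (n : ℕ) (q : Subset (suc n) → Bool) →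
  countSubsets (suc n) q ≡ countSubsets n (q ∘ consB false) + countSubsets n (q ∘ consB true)
countSubsets-suc n q = countB-pairs q (consB false) (consB true) (allSubsets n)

countSubsets-cong : (n : ℕ) {p q : Subset n → Bool} → (∀ S → p S ≡ q S) →
                    countSubsets n p ≡ countSubsets n q
countSubsets-cong n p≗q = countB-cong p≗q (allSubsets n)

countSubsets-≗const : (n : ℕ) (c : Bool) {q : Subset n → Bool} →
                      (∀ S → q S ≡ true ⇔ S ≗ (λ _ → c)) → countSubsets n q ≡ 1
countSubsets-≗const zero c {q} q⇔const =
  trans (countB-∷ q _ []) (cong (λ b → toℕ b + 0) (from (q⇔const _) (λ ())))
countSubsets-≗const (suc n) c {q} q⇔const = trans (countSubsets-suc n q) (halves c refl)
  where
  head≡c : ∀ b → b ≡ c → countSubsets n (q ∘ consB b) ≡ 1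
  head≡c b refl = countSubsets-≗const n b λ S → mk⇔
    (λ qS i → to (q⇔const (consB b S)) qS (suc i))
    (λ S≗b → from (q⇔const (consB b S)) λ { zero → refl ; (suc i) → S≗b i })
  head≢c : ∀ b → b ≢ c → countSubsets n (q ∘ consB b) ≡ 0
  head≢c b b≢c = countB-none _ (λ S → ¬-not λ qS → b≢c (to (q⇔const (consB b S)) qS zero)) (allSubsets n)
  halves : ∀ c′ → c′ ≡ c → countSubsets n (q ∘ consB false) + countSubsets n (q ∘ consB true) ≡ 1
  halves false f≡c = cong₂ _+_ (head≡c false f≡c) (head≢c true λ t≡c → true≢false (trans t≡c (sym f≡c)))
  halves true  t≡c = cong₂ _+_ (head≢c false λ f≡c → true≢false (trans t≡c (sym f≡c))) (head≡c true t≡c)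

Respects≗ : {n : ℕ} → (Subset n → Bool) → Set
Respects≗ q = ∀ {S S′} → S ≗ S′ → q S ≡ q S′

AgreeOutside : {n : ℕ} → Subset n → Subset n → Subset n → Set
AgreeOutside M S S′ = ∀ v → M v ≡ false → S v ≡ S′ v

ReadsOutside : {n : ℕ} → Subset n → (Subset n → Bool) → Set
ReadsOutside M h = ∀ {S S′} → AgreeOutside M S S′ → h S ≡ h S′

Respects≗-consB : {n : ℕ} {q : Subset (suc n) → Bool} (b : Bool) → Respects≗ q → Respects≗ (q ∘ consB b)
Respects≗-consB b q-resp S≗S′ = q-resp λ { zero → refl ; (suc v) → S≗S′ v }

ReadsOutside-consB : {n : ℕ} {M : Subset (suc n)} {h : Subset (suc n) → Bool} (b : Bool) →
                     ReadsOutside M h → ReadsOutside (M ∘ suc) (h ∘ consB b)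
ReadsOutside-consB b h-reads agree = h-reads λ { zero _ → refl ; (suc v) → agree v }

flipOn : {n : ℕ} → Subset n → Bool → Subset n → Subset n
flipOn M b S v = S v xor (M v ∧ b)

flipOn-inside : {n : ℕ} (M : Subset n) (b : Bool) (S : Subset n) {v : Fin n} → M v ≡ true →
                flipOn M b S v ≡ S v xor b
flipOn-inside M b S Mv rewrite Mv = refl

flipOn-outside : {n : ℕ} (M : Subset n) (b : Bool) (S : Subset n) {v : Fin n} → M v ≡ false →
                 flipOn M b S v ≡ S v
flipOn-outside M b S Mv rewrite Mv = xor-identityʳ _

flipOn-true-inside : {n : ℕ} (M S : Subset n) {v : Fin n} → M v ≡ true → flipOn M true S v ≡ not (S v)
flipOn-true-inside M S {v} Mv = trans (flipOn-inside M true S Mv) (xor-comm (S v) true)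

flipOn-involutive : {n : ℕ} (M : Subset n) (b : Bool) (S : Subset n) → flipOn M b (flipOn M b S) ≗ S
flipOn-involutive M b S v = begin
  (S v xor (M v ∧ b)) xor (M v ∧ b) ≡⟨ xor-assoc (S v) _ _ ⟩
  S v xor ((M v ∧ b) xor (M v ∧ b)) ≡⟨ cong (S v xor_) (xor-same (M v ∧ b)) ⟩
  S v xor false                     ≡⟨ xor-identityʳ (S v) ⟩
  S v                               ∎
  where open ≡-Reasoning

flipOn-consB : {n : ℕ} (M : Subset (suc n)) (c b : Bool) (S : Subset n) →
               flipOn M c (consB b S) ≗ consB (b xor (M zero ∧ c)) (flipOn (M ∘ suc) c S)
flipOn-consB M c b S zero    = refl
flipOn-consB M c b S (suc v) = refl

-- S ↦ flipOn M (h S) S is an involution because flipping inside M does not change h S.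
FlipInvariant : ℕ → Set
FlipInvariant n = ∀ {q : Subset n → Bool} (M : Subset n) (h : Subset n → Bool) →
  Respects≗ q → ReadsOutside M h → countSubsets n q ≡ countSubsets n (λ S → q (flipOn M (h S) S))

FlipInvariant-suc-unmasked : {n : ℕ} → FlipInvariant n → ∀ {q : Subset (suc n) → Bool} M h →
  Respects≗ q → ReadsOutside M h → M zero ≡ false →
  countSubsets (suc n) q ≡ countSubsets (suc n) (λ S → q (flipOn M (h S) S))
FlipInvariant-suc-unmasked {n} invariant {q} M h q-resp h-reads M₀ = begin
  countSubsets (suc n) q
    ≡⟨ countSubsets-suc n q ⟩
  countSubsets n (q ∘ consB false) + countSubsets n (q ∘ consB true)
    ≡⟨ cong₂ _+_ (flipTail false) (flipTail true) ⟩
  countSubsets n (flipped ∘ consB false) + countSubsets n (flipped ∘ consB true)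
    ≡⟨ countSubsets-suc n flipped ⟨
  countSubsets (suc n) flipped ∎
  where
  open ≡-Reasoning
  flipped : Subset (suc n) → Bool
  flipped S = q (flipOn M (h S) S)
  head-kept : ∀ b S c → flipOn M c (consB b S) ≗ consB b (flipOn (M ∘ suc) c S)
  head-kept b S c zero    rewrite M₀ = xor-identityʳ b
  head-kept b S c (suc v) = refl
  flipTail : ∀ b → countSubsets n (q ∘ consB b) ≡ countSubsets n (flipped ∘ consB b)
  flipTail b = trans (invariant (M ∘ suc) (h ∘ consB b) (Respects≗-consB b q-resp) (ReadsOutside-consB b h-reads))
                     (countSubsets-cong n λ S → q-resp (sym ∘ head-kept b S _))

-- The head bit is flipped by c S, which depends only on the tail: the two halves are exchanged.
FlipInvariant-suc-masked : {n : ℕ} → FlipInvariant n → ∀ {q : Subset (suc n) → Bool} M h →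
  Respects≗ q → ReadsOutside M h → M zero ≡ true →
  countSubsets (suc n) q ≡ countSubsets (suc n) (λ S → q (flipOn M (h S) S))
FlipInvariant-suc-masked {n} invariant {q} M h q-resp h-reads M₀ = begin
  countSubsets (suc n) q
    ≡⟨ countSubsets-suc n q ⟩
  countSubsets n (q ∘ consB false) + countSubsets n (q ∘ consB true)
    ≡⟨ cong₂ _+_ (flipTail false) (flipTail true) ⟩
  countSubsets n (λ S → q (consB false (F S))) + countSubsets n (λ S → q (consB true (F S)))
    ≡⟨ countB-+ (λ S → toℕ-sum-xor (λ b → q (consB b (F S))) (c S)) (allSubsets n) ⟩
  countSubsets n (λ S → q (consB (false xor c S) (F S))) + countSubsets n (λ S → q (consB (true xor c S) (F S)))
    ≡⟨ cong₂ _+_ (countSubsets-cong n (flipHead false)) (countSubsets-cong n (flipHead true)) ⟩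
  countSubsets n (flipped ∘ consB false) + countSubsets n (flipped ∘ consB true)
    ≡⟨ countSubsets-suc n flipped ⟨
  countSubsets (suc n) flipped ∎
  where
  open ≡-Reasoning
  flipped : Subset (suc n) → Bool
  flipped S = q (flipOn M (h S) S)
  c : Subset n → Bool
  c = h ∘ consB false
  F : Subset n → Subset n
  F S = flipOn (M ∘ suc) (c S) S
  h-ignores-head : ∀ b S → h (consB b S) ≡ c S
  h-ignores-head b S = h-reads λ { zero M₀≡false → contradiction (trans (sym M₀) M₀≡false) true≢false
                                 ; (suc v) _     → refl }
  flipTail : ∀ b → countSubsets n (q ∘ consB b) ≡ countSubsets n (λ S → q (consB b (F S)))
  flipTail b = invariant (M ∘ suc) c (Respects≗-consB b q-resp) (ReadsOutside-consB false h-reads)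
  flipHead : ∀ b S → q (consB (b xor c S) (F S)) ≡ flipped (consB b S)
  flipHead b S = q-resp λ v → sym (trans (flipOn-consB M _ b S v) (head-flipped v))
    where
    head-flipped : consB (b xor (M zero ∧ h (consB b S))) (flipOn (M ∘ suc) (h (consB b S)) S)
                   ≗ consB (b xor c S) (F S)
    head-flipped zero    rewrite M₀ | h-ignores-head b S = refl
    head-flipped (suc v) rewrite h-ignores-head b S = refl

countSubsets-flipOn : (n : ℕ) → FlipInvariant n
countSubsets-flipOn zero    M h q-resp _ = countSubsets-cong zero (λ S → q-resp (λ ()))
countSubsets-flipOn (suc n) M h q-resp h-reads with M zero in M₀
... | false = FlipInvariant-suc-unmasked (countSubsets-flipOn n) M h q-resp h-reads M₀
... | true  = FlipInvariant-suc-masked   (countSubsets-flipOn n) M h q-resp h-reads M₀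

-- Partitions into two dominating sets

OppositeNeighbour : {n : ℕ} → Graph n → Subset n → Subset n → Fin n → Set
OppositeNeighbour {n} G U S v = ∃ λ u → U u ≡ true × adj G v u ≡ true × S u ≡ not (S v)

-- Nonemptiness of S and U ∖ S is not a field: it follows from dominated once U is inhabited.
record DominatingSplit {n : ℕ} (G : Graph n) (U S : Subset n) : Set where
  field
    ⊆U        : ∀ v → S v ≡ true → U v ≡ true
    inhabited : ∃ λ v → U v ≡ true
    dominated : ∀ v → U v ≡ true → OppositeNeighbour G U S v

  both-colours : (∃ λ v → S v ≡ true) × (∃ λ v → U v ≡ true × S v ≡ false)
  both-colours with inhabited
  ... | v , Uv with S v in Sv | dominated v Uv
  ... | true  | u , Uu , _ , Su = (v , Sv) , (u , Uu , Su)
  ... | false | u , Uu , _ , Su = (u , Su) , (v , Uv , Sv)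

  ∉U⇒∉S : ∀ {v} → U v ≡ false → S v ≡ false
  ∉U⇒∉S {v} Uv = ¬-not λ Sv → true≢false (trans (sym (⊆U v Sv)) Uv)
open DominatingSplit

module _ {n : ℕ} (G : Graph n) (U S : Subset n) where

  private
    Sᶜ : Subset n
    Sᶜ v = U v ∧ not (S v)
    S⊆Uᵇ S≠∅ᵇ Sᶜ≠∅ᵇ S-domᵇ Sᶜ-domᵇ : Bool
    S⊆Uᵇ    = all (λ v → not (S v) ∨ U v) (allFin n)
    S≠∅ᵇ    = any S (allFin n)
    Sᶜ≠∅ᵇ   = any Sᶜ (allFin n)
    S-domᵇ  = dominatingIn G U S
    Sᶜ-domᵇ = dominatingIn G U Sᶜ

    conjuncts⁻ : goodPart G U S ≡ true → T S⊆Uᵇ × T S≠∅ᵇ × T Sᶜ≠∅ᵇ × T S-domᵇ × T Sᶜ-domᵇ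
    conjuncts⁻ good =
      let (a , good) = to (T-∧ {S⊆Uᵇ}) (from T-≡ good)
          (b , good) = to (T-∧ {S≠∅ᵇ}) good
          (c , good) = to (T-∧ {Sᶜ≠∅ᵇ}) good
      in a , b , c , to (T-∧ {S-domᵇ}) good

    conjuncts⁺ : T S⊆Uᵇ × T S≠∅ᵇ × T Sᶜ≠∅ᵇ × T S-domᵇ × T Sᶜ-domᵇ → goodPart G U S ≡ true
    conjuncts⁺ (a , b , c , d , e) =
      to T-≡ (from (T-∧ {S⊆Uᵇ}) (a , from (T-∧ {S≠∅ᵇ}) (b , from (T-∧ {Sᶜ≠∅ᵇ}) (c , from (T-∧ {S-domᵇ}) (d , e)))))

  goodPart⇒DominatingSplit : goodPart G U S ≡ true → DominatingSplit G U S
  goodPart⇒DominatingSplit good = record { ⊆U = S⊆U ; inhabited = U-inhabited ; dominated = U-dominated }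
    where
    S⊆U : ∀ v → S v ≡ true → U v ≡ true
    S⊆U v Sv = to T-≡ (T-⇒⁻ (all-allFin⁻ _ (proj₁ (conjuncts⁻ good)) v) (from T-≡ Sv))

    U-inhabited : ∃ λ v → U v ≡ true
    U-inhabited with any-allFin⁻ S (proj₁ (proj₂ (conjuncts⁻ good)))
    ... | v , Sv = v , S⊆U v (to T-≡ Sv)

    U-dominated : ∀ v → U v ≡ true → OppositeNeighbour G U S v
    U-dominated v Uv with S v in Sv
    ... | false with any-allFin⁻ _ (T-∨-resolve Sv (T-⇒⁻ (all-allFin⁻ _ S-dom v) (from T-≡ Uv)))
      where S-dom = proj₁ (proj₂ (proj₂ (proj₂ (conjuncts⁻ good))))
    ...   | u , Su∧vu with to (T-∧ {S u}) Su∧vu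
    ...     | Su , vu = u , S⊆U u (to T-≡ Su) , to T-≡ vu , to T-≡ Su
    U-dominated v Uv | true with any-allFin⁻ _ (T-∨-resolve Sᶜv (T-⇒⁻ (all-allFin⁻ _ Sᶜ-dom v) (from T-≡ Uv)))
      where Sᶜ-dom = proj₂ (proj₂ (proj₂ (proj₂ (conjuncts⁻ good))))
            Sᶜv = trans (cong (λ b → U v ∧ not b) Sv) (∧-zeroʳ (U v))
    ...   | u , Sᶜu∧vu with to (T-∧ {Sᶜ u}) Sᶜu∧vu
    ...     | Sᶜu , vu with to (T-∧ {U u}) Sᶜu
    ...       | Uu , ¬Su = u , to T-≡ Uu , to T-≡ vu , to T-not-≡ ¬Su

  DominatingSplit⇒goodPart : DominatingSplit G U S → goodPart G U S ≡ true
  DominatingSplit⇒goodPart split = conjuncts⁺ (S⊆Uᵇ-holds , S≠∅ , Sᶜ≠∅ , S-dom , Sᶜ-dom)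
    where
    S⊆Uᵇ-holds : T S⊆Uᵇ
    S⊆Uᵇ-holds = all-allFin⁺ _ λ v → T-⇒⁺ λ Sv → from T-≡ (⊆U split v (to T-≡ Sv))

    S≠∅ : T S≠∅ᵇ
    S≠∅ with proj₁ (both-colours split)
    ... | v , Sv = any-allFin⁺ S v (from T-≡ Sv)

    Sᶜ≠∅ : T Sᶜ≠∅ᵇ
    Sᶜ≠∅ with proj₂ (both-colours split)
    ... | v , Uv , Sv = any-allFin⁺ Sᶜ v (from (T-∧ {U v}) (from T-≡ Uv , from T-not-≡ Sv))

    dominated-by-S : ∀ v → U v ≡ true → T (S v ∨ any (λ u → S u ∧ adj G v u) (allFin n))
    dominated-by-S v Uv with S v in Sv | dominated split v Uv
    ... | true  | _ = tt
    ... | false | u , _ , vu , Su = any-allFin⁺ _ u (from (T-∧ {S u}) (from T-≡ Su , from T-≡ vu))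

    S-dom : T S-domᵇ
    S-dom = all-allFin⁺ _ λ v → T-⇒⁺ (λ Uv → dominated-by-S v (to T-≡ Uv))

    dominated-by-Sᶜ : ∀ v → U v ≡ true → T (Sᶜ v ∨ any (λ u → Sᶜ u ∧ adj G v u) (allFin n))
    dominated-by-Sᶜ v Uv with S v in Sv | dominated split v Uv
    ... | false | _ rewrite Uv = tt
    ... | true  | u , Uu , vu , Su rewrite Uv =
      any-allFin⁺ _ u (from (T-∧ {Sᶜ u}) (from (T-∧ {U u}) (from T-≡ Uu , from T-not-≡ Su) , from T-≡ vu))

    Sᶜ-dom : T Sᶜ-domᵇ
    Sᶜ-dom = all-allFin⁺ _ λ v → T-⇒⁺ (λ Uv → dominated-by-Sᶜ v (to T-≡ Uv))

DominatingSplit-≗ : {n : ℕ} {G : Graph n} {U S S′ : Subset n} → S ≗ S′ →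
                    DominatingSplit G U S → DominatingSplit G U S′
DominatingSplit-≗ S≗S′ split = record
  { ⊆U        = λ v S′v → ⊆U split v (trans (S≗S′ v) S′v)
  ; inhabited = inhabited split
  ; dominated = λ v Uv → let (u , Uu , vu , Su) = dominated split v Uv in
                u , Uu , vu , trans (sym (S≗S′ u)) (trans Su (cong not (S≗S′ v)))
  }

goodPart-resp : {n : ℕ} (G : Graph n) (U : Subset n) → Respects≗ (goodPart G U)
goodPart-resp G U S≗S′ = ⇔→≡ (mk⇔
  (DominatingSplit⇒goodPart G U _ ∘ DominatingSplit-≗ S≗S′ ∘ goodPart⇒DominatingSplit G U _)
  (DominatingSplit⇒goodPart G U _ ∘ DominatingSplit-≗ (sym ∘ S≗S′) ∘ goodPart⇒DominatingSplit G U _))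

DominatingSplit-complement : {n : ℕ} {G : Graph n} {U S : Subset n} →
                             DominatingSplit G U S → DominatingSplit G U (flipOn U true S)
DominatingSplit-complement {U = U} {S} split = record
  { ⊆U        = complement⊆U
  ; inhabited = inhabited split
  ; dominated = λ v Uv → let (u , Uu , vu , Su) = dominated split v Uv in
      u , Uu , vu , trans (flipOn-true-inside U S Uu) (cong not (trans Su (sym (flipOn-true-inside U S Uv))))
  }
  where
  complement⊆U : ∀ v → flipOn U true S v ≡ true → U v ≡ true
  complement⊆U v Sᶜv with U v in Uv
  ... | true  = refl
  ... | false = trans (sym Uv) (⊆U split v (trans (sym (xor-identityʳ (S v))) Sᶜv))

goodPart-complement : {n : ℕ} (G : Graph n) (U S : Subset n) → goodPart G U (flipOn U true S) ≡ goodPart G U S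
goodPart-complement G U S = ⇔→≡ (mk⇔
  (DominatingSplit⇒goodPart G U S ∘ DominatingSplit-≗ (flipOn-involutive U true S)
    ∘ DominatingSplit-complement ∘ goodPart⇒DominatingSplit G U _)
  (DominatingSplit⇒goodPart G U _ ∘ DominatingSplit-complement ∘ goodPart⇒DominatingSplit G U S))

countGood : {n : ℕ} → Graph n → Subset n → ℕ
countGood {n} G U = countSubsets n (goodPart G U)

-- Complementing within U exchanges the good subsets containing w with those avoiding it.
countGood-double : {n : ℕ} (G : Graph n) (U : Subset n) {w : Fin n} → U w ≡ true →
  countGood G U ≡ countSubsets n (λ S → goodPart G U S ∧ S w) + countSubsets n (λ S → goodPart G U S ∧ S w)
countGood-double {n} G U {w} Uw = begin
  countGood G U
    ≡⟨ countB-split (λ S → toℕ-∧-split (goodPart G U S) (S w)) (allSubsets n) ⟩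
  k + countSubsets n (λ S → goodPart G U S ∧ not (S w))
    ≡⟨ cong (k +_) (countSubsets-flipOn n U (λ _ → true) avoids-w-resp (λ _ → refl)) ⟩
  k + countSubsets n (λ S → goodPart G U (flipOn U true S) ∧ not (flipOn U true S w))
    ≡⟨ cong (k +_) (countSubsets-cong n λ S → cong₂ _∧_ (goodPart-complement G U S)
                                                        (trans (cong not (flipOn-true-inside U S Uw)) (not-involutive (S w)))) ⟩
  k + k ∎
  where
  open ≡-Reasoning
  k = countSubsets n (λ S → goodPart G U S ∧ S w)
  avoids-w-resp : Respects≗ (λ S → goodPart G U S ∧ not (S w))
  avoids-w-resp S≗S′ = cong₂ _∧_ (goodPart-resp G U S≗S′) (cong not (S≗S′ w))

countGood≡2*w₂On : {n : ℕ} (G : Graph n) (U : Subset n) {w : Fin n} → U w ≡ true →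
                   countGood G U ≡ 2 * w₂On G U
countGood≡2*w₂On {n} G U {w} Uw = trans double (cong (2 *_) (sym halve))
  where
  k = countSubsets n (λ S → goodPart G U S ∧ S w)
  double : countGood G U ≡ 2 * k
  double = trans (countGood-double G U Uw) (cong (k +_) (sym (+-identityʳ k)))
  halve : w₂On G U ≡ k
  halve = trans (cong (_/ 2) (trans double (*-comm 2 k))) (m*n/n≡m k 2)

-- Quasi-star vertices

eqFin-refl : {n : ℕ} (u : Fin n) → eqFin u u ≡ true
eqFin-refl zero    = refl
eqFin-refl (suc u) = eqFin-refl u

eqFin-≢ : {n : ℕ} {u v : Fin n} → u ≢ v → eqFin u v ≡ false
eqFin-≢ {u = zero}  {zero}  u≢v = contradiction refl u≢v
eqFin-≢ {u = zero}  {suc v} _   = refl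
eqFin-≢ {u = suc u} {zero}  _   = refl
eqFin-≢ {u = suc u} {suc v} u≢v = eqFin-≢ (u≢v ∘ cong suc)

leaf-neighbour-unique : {n : ℕ} (G : Graph n) {l u w : Fin n} → isLeaf G l ≡ true →
                        adj G l u ≡ true → adj G l w ≡ true → u ≡ w
leaf-neighbour-unique {n} G {l} l-leaf lu lw with countB-tabulate≡1 (adj G l) (λ i → i) degree≡1
  where degree≡1 = ≡ᵇ⇒≡ (degree G l) 1 (from T-≡ l-leaf)
... | _ , _ , unique = trans (sym (unique lu)) (unique lw)

module QuasiStarVertex {n : ℕ} (G : Graph n) (y x ℓ : Fin n)
  (y~x : adj G y x ≡ true) (x∉L : inOnes G y x ≡ false)
  (only-x : ∀ {u} → adj G y u ≡ true → inOnes G y u ≡ false → u ≡ x)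
  (ℓ∈L : inOnes G y ℓ ≡ true) where

  L V V₁ V₂ : Subset n
  L  = inOnes G y
  V  = λ _ → true
  V₁ = minus1 G y
  V₂ = minus2 G y

  adj-sym : ∀ {u v} → adj G u v ≡ true → adj G v u ≡ true
  adj-sym {u} {v} uv = trans (Graph.sym G v u) uv

  L⇒y~ : ∀ {l} → L l ≡ true → adj G y l ≡ true
  L⇒y~ = ∧≡true⇒ˡ

  leaf-attached : ∀ {l u} → L l ≡ true → adj G l u ≡ true → u ≡ y
  leaf-attached {l} l∈L lu = leaf-neighbour-unique G (∧≡true⇒ʳ {adj G y l} l∈L) lu (adj-sym (L⇒y~ l∈L))

  y∉L : L y ≡ false
  y∉L = cong (_∧ isLeaf G y) (irrefl G y)

  x≢y : x ≢ y
  x≢y refl = true≢false (trans (sym y~x) (irrefl G y))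

  L⇒≢y : ∀ {v} → L v ≡ true → v ≢ y
  L⇒≢y v∈L refl = true≢false (trans (sym v∈L) y∉L)

  neighbour-∉L : ∀ {u v} → v ≢ y → adj G v u ≡ true → L u ≡ false
  neighbour-∉L v≢y vu = ¬-not λ u∈L → v≢y (leaf-attached u∈L (adj-sym vu))

  ∈V₁ : ∀ {v} → L v ≡ false → V₁ v ≡ true
  ∈V₁ = cong not

  ∈V₁⁻ : ∀ {v} → V₁ v ≡ true → L v ≡ false
  ∈V₁⁻ = not-injective

  ∈V₂ : ∀ {v} → L v ≡ false → v ≢ y → V₂ v ≡ true
  ∈V₂ v∉L v≢y = cong₂ (λ a b → not a ∧ not b) v∉L (eqFin-≢ v≢y)

  ∈V₂⁻ : ∀ {v} → V₂ v ≡ true → L v ≡ false × v ≢ y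
  ∈V₂⁻ {v} v∈V₂ with L v | eqFin v y in v=y | v∈V₂
  ... | false | false | _ = refl , λ { refl → true≢false (trans (sym (eqFin-refl y)) v=y) }

  L∩V₂≡∅ : ∀ {l} → L l ≡ true → V₂ l ≡ false
  L∩V₂≡∅ l∈L = cong (λ a → not a ∧ _) l∈L

  y∉V₂ : V₂ y ≡ false
  y∉V₂ = trans (cong (λ b → not (L y) ∧ not b) (eqFin-refl y)) (∧-zeroʳ _)

  isY : Subset n
  isY v = eqFin v y

  -- If S splits V, toggleLeaves S removes L from S, and toggleY then removes y when y lies with x.
  toggleLeaves toggleY toV₂ : Subset n → Subset n
  toggleLeaves S = flipOn L (not (S y)) S
  toggleY S      = flipOn isY (S x) S
  toV₂           = toggleY ∘ toggleLeaves

  toggleLeaves-outside : ∀ S {v} → L v ≡ false → toggleLeaves S v ≡ S v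
  toggleLeaves-outside S {v} = flipOn-outside L (not (S y)) S {v}

  toggleLeaves-leaf : ∀ S {l} → L l ≡ true → toggleLeaves S l ≡ false ⇔ S l ≡ not (S y)
  toggleLeaves-leaf S {l} l∈L = mk⇔
    (λ cleared → xor≡false⇒≡ (trans (sym (flipOn-inside L _ S {l} l∈L)) cleared))
    (λ opposite → trans (flipOn-inside L _ S {l} l∈L) (≡⇒xor≡false opposite))

  toV₂-outside : ∀ S {v} → L v ≡ false → v ≢ y → toV₂ S v ≡ S v
  toV₂-outside S v∉L v≢y = trans (flipOn-outside isY (toggleLeaves S x) (toggleLeaves S) (eqFin-≢ v≢y))
                                 (toggleLeaves-outside S v∉L)

  toV₂-leaf : ∀ S {l} → L l ≡ true → toV₂ S l ≡ toggleLeaves S l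
  toV₂-leaf S l∈L = flipOn-outside isY (toggleLeaves S x) (toggleLeaves S) (eqFin-≢ (L⇒≢y l∈L))

  toV₂-y : ∀ S → toV₂ S y ≡ S y xor S x
  toV₂-y S = trans (flipOn-inside isY (toggleLeaves S x) (toggleLeaves S) (eqFin-refl y))
                   (cong₂ _xor_ (toggleLeaves-outside S y∉L) (toggleLeaves-outside S x∉L))

  DominatingSplit-V⁺ : ∀ {S} → (∀ v → OppositeNeighbour G V S v) → DominatingSplit G V S
  DominatingSplit-V⁺ opposite = record
    { ⊆U = λ _ _ → refl ; inhabited = y , refl ; dominated = λ v _ → opposite v }

  DominatingSplit-V⁻ : ∀ {S} → DominatingSplit G V S → ∀ v → OppositeNeighbour G V S v
  DominatingSplit-V⁻ split v = dominated split v refl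

  leaves-oppose-y : ∀ {S} → DominatingSplit G V S → ∀ {l} → L l ≡ true → S l ≡ not (S y)
  leaves-oppose-y {S} split {l} l∈L with DominatingSplit-V⁻ split l
  ... | u , _ , lu , Su with leaf-attached l∈L lu
  ...   | refl = ≡not-sym Su

  split-V⇒V₁ : ∀ {S} → DominatingSplit G V S → S x ≡ not (S y) → DominatingSplit G V₁ (toggleLeaves S)
  split-V⇒V₁ {S} split Sx = record
    { ⊆U        = λ v v∈S → ∈V₁ (¬-not λ v∈L → true≢false
                    (trans (sym v∈S) (from (toggleLeaves-leaf S v∈L) (leaves-oppose-y split v∈L))))
    ; inhabited = y , ∈V₁ y∉L
    ; dominated = dominated₁
    }
    where
    dominated₁ : ∀ v → V₁ v ≡ true → OppositeNeighbour G V₁ (toggleLeaves S) v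
    dominated₁ v v∈V₁ with v ≟ y
    ... | yes refl = x , ∈V₁ x∉L , y~x , ≡not-resp (toggleLeaves-outside S x∉L) (toggleLeaves-outside S y∉L) Sx
    ... | no v≢y with DominatingSplit-V⁻ split v
    ...   | u , _ , vu , Su =
      u , ∈V₁ u∉L , vu , ≡not-resp (toggleLeaves-outside S u∉L) (toggleLeaves-outside S (∈V₁⁻ v∈V₁)) Su
      where u∉L = neighbour-∉L v≢y vu

  split-V₁⇒V : ∀ {S} → DominatingSplit G V₁ (toggleLeaves S) → DominatingSplit G V S
  split-V₁⇒V {S} split = DominatingSplit-V⁺ opposite
    where
    opposite : ∀ v → OppositeNeighbour G V S v
    opposite v with L v in v∈L
    ... | true  = y , refl , adj-sym (L⇒y~ v∈L) ,
                  ≡not-sym (to (toggleLeaves-leaf S v∈L) (∉U⇒∉S split (cong not v∈L)))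
    ... | false with dominated split v (∈V₁ v∈L)
    ...   | u , u∈V₁ , vu , Su =
      u , refl , vu , ≡not-resp (sym (toggleLeaves-outside S (∈V₁⁻ u∈V₁))) (sym (toggleLeaves-outside S v∈L)) Su

  split-V₁⇒Sx≡¬Sy : ∀ {S} → DominatingSplit G V₁ (toggleLeaves S) → S x ≡ not (S y)
  split-V₁⇒Sx≡¬Sy {S} split with dominated split y (∈V₁ y∉L)
  ... | u , u∈V₁ , yu , Su with only-x yu (∈V₁⁻ u∈V₁)
  ...   | refl = ≡not-resp (sym (toggleLeaves-outside S x∉L)) (sym (toggleLeaves-outside S y∉L)) Su

  split-V⇒V₂ : ∀ {S} → DominatingSplit G V S → S x ≡ S y → DominatingSplit G V₂ (toV₂ S)
  split-V⇒V₂ {S} split Sx≡Sy = record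
    { ⊆U        = λ v v∈S → ∈V₂ (¬-not (leaf-excluded v∈S)) (y-excluded v∈S)
    ; inhabited = x , ∈V₂ x∉L x≢y
    ; dominated = dominated₂
    }
    where
    leaf-excluded : ∀ {v} → toV₂ S v ≡ true → L v ≢ true
    leaf-excluded v∈S v∈L = true≢false (trans (sym v∈S) (trans (toV₂-leaf S v∈L)
                              (from (toggleLeaves-leaf S v∈L) (leaves-oppose-y split v∈L))))
    y-excluded : ∀ {v} → toV₂ S v ≡ true → v ≢ y
    y-excluded v∈S refl = true≢false (trans (sym v∈S) (trans (toV₂-y S) (≡⇒xor≡false (sym Sx≡Sy))))
    dominated₂ : ∀ v → V₂ v ≡ true → OppositeNeighbour G V₂ (toV₂ S) v
    dominated₂ v v∈V₂ with ∈V₂⁻ v∈V₂ | DominatingSplit-V⁻ split v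
    ... | v∉L , v≢y | u , _ , vu , Su =
      u , ∈V₂ u∉L u≢y , vu , ≡not-resp (toV₂-outside S u∉L u≢y) (toV₂-outside S v∉L v≢y) Su
      where
      u∉L = neighbour-∉L v≢y vu
      u≢y : u ≢ y
      u≢y refl with only-x (adj-sym vu) v∉L
      ... | refl = not-¬ refl (trans Su (cong not Sx≡Sy))

  split-V₂⇒V : ∀ {S} → DominatingSplit G V₂ (toV₂ S) → DominatingSplit G V S
  split-V₂⇒V {S} split = DominatingSplit-V⁺ opposite
    where
    leaf-opposite : ∀ {l} → L l ≡ true → S l ≡ not (S y)
    leaf-opposite l∈L = to (toggleLeaves-leaf S l∈L) (trans (sym (toV₂-leaf S l∈L)) (∉U⇒∉S split (L∩V₂≡∅ l∈L)))
    opposite : ∀ v → OppositeNeighbour G V S v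
    opposite v with L v in v∈L | v ≟ y
    ... | true  | _        = y , refl , adj-sym (L⇒y~ v∈L) , ≡not-sym (leaf-opposite v∈L)
    ... | false | yes refl = ℓ , refl , L⇒y~ ℓ∈L , leaf-opposite ℓ∈L
    ... | false | no v≢y with dominated split v (∈V₂ v∈L v≢y)
    ...   | u , u∈V₂ , vu , Su with ∈V₂⁻ u∈V₂
    ...     | u∉L , u≢y = u , refl , vu , ≡not-resp (sym (toV₂-outside S u∉L u≢y)) (sym (toV₂-outside S v∈L v≢y)) Su

  split-V₂⇒Sx≡Sy : ∀ {S} → DominatingSplit G V₂ (toV₂ S) → S x ≡ S y
  split-V₂⇒Sx≡Sy {S} split = sym (xor≡false⇒≡ (trans (sym (toV₂-y S)) (∉U⇒∉S split y∉V₂)))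

  goodPart-V⇔ : ∀ S → goodPart G V S ≡ true ⇔
                (goodPart G V₁ (toggleLeaves S) ≡ true ⊎ goodPart G V₂ (toV₂ S) ≡ true)
  goodPart-V⇔ S = mk⇔ (classify ∘ goodPart⇒DominatingSplit G V S)
    [ DominatingSplit⇒goodPart G V S ∘ split-V₁⇒V ∘ goodPart⇒DominatingSplit G V₁ _
    , DominatingSplit⇒goodPart G V S ∘ split-V₂⇒V ∘ goodPart⇒DominatingSplit G V₂ _ ]
    where
    classify : DominatingSplit G V S → goodPart G V₁ (toggleLeaves S) ≡ true ⊎ goodPart G V₂ (toV₂ S) ≡ true
    classify split with S x ≟ᵇ S y
    ... | yes Sx≡Sy = inj₂ (DominatingSplit⇒goodPart G V₂ _ (split-V⇒V₂ split Sx≡Sy))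
    ... | no  Sx≢Sy = inj₁ (DominatingSplit⇒goodPart G V₁ _ (split-V⇒V₁ split (¬-not Sx≢Sy)))

  goodPart-V₁-V₂-exclusive : ∀ S → ¬ (goodPart G V₁ (toggleLeaves S) ≡ true × goodPart G V₂ (toV₂ S) ≡ true)
  goodPart-V₁-V₂-exclusive S (good₁ , good₂) =
    not-¬ (split-V₂⇒Sx≡Sy {S} (goodPart⇒DominatingSplit G V₂ _ good₂))
          (split-V₁⇒Sx≡¬Sy {S} (goodPart⇒DominatingSplit G V₁ _ good₁))

  countGood-V : countGood G V ≡ countGood G V₁ + countGood G V₂
  countGood-V = begin
    countGood G V
      ≡⟨ countB-split (λ S → toℕ-exclusive-or (goodPart-V⇔ S) (goodPart-V₁-V₂-exclusive S)) (allSubsets n) ⟩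
    countSubsets n (goodPart G V₁ ∘ toggleLeaves) + countSubsets n (goodPart G V₂ ∘ toggleY ∘ toggleLeaves)
      ≡⟨ cong₂ _+_ (countSubsets-flipOn n L (λ S → not (S y)) (goodPart-resp G V₁) reads-y)
                   (trans (countSubsets-flipOn n isY (λ S → S x) (goodPart-resp G V₂) reads-x)
                          (countSubsets-flipOn n L (λ S → not (S y)) (goodPart-resp G V₂ ∘ toggleY-resp) reads-y)) ⟨
    countGood G V₁ + countGood G V₂ ∎
    where
    open ≡-Reasoning
    reads-y : ReadsOutside L (λ S → not (S y))
    reads-y agree = cong not (agree y y∉L)
    reads-x : ReadsOutside isY (λ S → S x)
    reads-x agree = agree x (eqFin-≢ x≢y)
    toggleY-resp : ∀ {S S′} → S ≗ S′ → toggleY S ≗ toggleY S′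
    toggleY-resp S≗S′ v = cong₂ _xor_ (S≗S′ v) (cong (isY v ∧_) (S≗S′ x))

  w₂-recurrence : w₂ G ≡ w₂On G V₁ + w₂On G V₂
  w₂-recurrence = *-cancelˡ-≡ _ _ 2 (begin
    2 * w₂ G                          ≡⟨ countGood≡2*w₂On G V {y} refl ⟨
    countGood G V                     ≡⟨ countGood-V ⟩
    countGood G V₁ + countGood G V₂   ≡⟨ cong₂ _+_ (countGood≡2*w₂On G V₁ (∈V₁ y∉L))
                                                   (countGood≡2*w₂On G V₂ (∈V₂ x∉L x≢y)) ⟩
    2 * w₂On G V₁ + 2 * w₂On G V₂     ≡⟨ *-distribˡ-+ 2 (w₂On G V₁) (w₂On G V₂) ⟨
    2 * (w₂On G V₁ + w₂On G V₂)       ∎)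
    where open ≡-Reasoning

w₂-quasiStar : {n : ℕ} (G : Graph n) (y : Fin n) → IsQuasiStar G y →
               w₂ G ≡ w₂On G (minus1 G y) + w₂On G (minus2 G y)
w₂-quasiStar G y (one-nonleaf , ℓ , y~ℓ , ℓ-leaf) with countB-tabulate≡1 _ (λ i → i) one-nonleaf
... | x , y~x∧nonleaf , unique =
  QuasiStarVertex.w₂-recurrence G y x ℓ y~x x∉L only-x (cong₂ _∧_ y~ℓ ℓ-leaf)
  where
  y~x = ∧≡true⇒ˡ y~x∧nonleaf
  x∉L : inOnes G y x ≡ false
  x∉L = trans (cong (adj G y x ∧_) (not-injective (∧≡true⇒ʳ {adj G y x} y~x∧nonleaf))) (∧-zeroʳ _)
  only-x : ∀ {u} → adj G y u ≡ true → inOnes G y u ≡ false → u ≡ x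
  only-x {u} y~u u∉L = sym (unique (cong₂ (λ a b → a ∧ not b) y~u u-nonleaf))
    where u-nonleaf = trans (cong (_∧ isLeaf G u) (sym y~u)) u∉L

-- Stars

star-goodPart⇔ : (r : ℕ) (b : Bool) (S : Subset (suc r)) →
                 goodPart (K1 (suc r)) (λ _ → true) (consB b S) ≡ true ⇔ S ≗ (λ _ → not b)
star-goodPart⇔ r b S = mk⇔
  (λ good → leaf-opposite (goodPart⇒DominatingSplit K V (consB b S) good))
  (λ S≗¬b → DominatingSplit⇒goodPart K V (consB b S) (record
    { ⊆U        = λ _ _ → refl
    ; inhabited = zero , refl
    ; dominated = λ { zero _    → suc zero , refl , refl , S≗¬b zero
                    ; (suc i) _ → zero , refl , refl , ≡not-sym (S≗¬b i) }
    }))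
  where
  K = K1 (suc r)
  V : Subset (suc (suc r))
  V _ = true
  leaf-opposite : DominatingSplit K V (consB b S) → ∀ i → S i ≡ not b
  leaf-opposite split i with dominated split (suc i) refl
  ... | zero , _ , _ , b≡¬Si = ≡not-sym b≡¬Si

w₂-star : (r : ℕ) → w₂ (K1 (suc r)) ≡ 1
w₂-star r = cong (_/ 2) (trans (countSubsets-suc (suc r) _)
  (cong₂ _+_ (countSubsets-≗const (suc r) true (star-goodPart⇔ r false))
             (countSubsets-≗const (suc r) false (star-goodPart⇔ r true))))

mainTheorem4 : ((n : ℕ) (T : Graph n) → 4 ≤ n → IsTree T → (y : Fin n) → IsQuasiStar T y →
                  w₂ T ≡ w₂On T (minus1 T y) + w₂On T (minus2 T y))
               × ((r : ℕ) → 1 ≤ r → w₂ (K1 r) ≡ 1)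
mainTheorem4 = (λ n T _ _ y quasiStar → w₂-quasiStar T y quasiStar)
             , λ { zero () ; (suc r) _ → w₂-star r }
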